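{- Let $G$ be a finite simple graph and let $x$ be a construction sequence for $G$ with $\nu(x)=\nu^*(G)$. If the vertices of $G$ appear in $x$ in the order $v_1,\dots,v_n$, then $\deg(v_i)\ge\deg(v_{i+1})$ for all $1\le i<n$.
   Context: For a finite simple graph $G=(V,E)$ with $p=|V|$, $q=|E|$, $\ell=p+q$, a construction sequence (c-sequence) for $G$ is a bijection $x:\{1,\dots,\ell\}\to V\sqcup E$ such that for every edge $e=uw$, $x^{ -1}(e)>\max\{x^{ -1}(u),x^{ -1}(w)\}$. The cost of an edge $e=uw$ in $x$ is $\nu(e,x)=(x^{ -1}(e)-x^{ -1}(u))+(x^{ -1}(e)-x^{ -1}(w))$, and the cost of $x$ is $\nu(x)=\sum_{e\in E}\nu(e,x)$. The max cost is $\nu^*(G)=\max\nu(x)$ over all c-sequences $x$ for $G$. -}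

module Defs where

open import Data.Nat using (ℕ; _+_; _∸_; _<_; _≤_)
open import Data.Fin using (Fin; toℕ; _≟_)
open import Data.Fin.Properties using ()
open import Data.Sum using (_⊎_; inj₁; inj₂)
open import Data.Product using (_×_; _,_; proj₁; proj₂; ∃-syntax)
open import Data.List using (tabulate)
open import Data.Nat.ListAction using (sum)
open import Data.Bool using (if_then_else_)
open import Relation.Nullary using (¬_)
open import Relation.Nullary.Decidable using (⌊_⌋; _⊎-dec_)
open import Relation.Binary.PropositionalEquality using (_≡_)
open import Function.Bundles using (_↔_; Inverse)
open import Function.Definitions using (Injective)

-- A finite simple graph: vertex set Fin p, edge set Fin q, each edge e has
-- endpoints (u , w) with u < w (no loops, canonical orientation), and
-- distinct edges have distinct endpoint pairs (no multi-edges).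
record Graph : Set where
  field
    p     : ℕ
    q     : ℕ
    ends  : Fin q → Fin p × Fin p
    ordered : ∀ e → toℕ (proj₁ (ends e)) < toℕ (proj₂ (ends e))
    simple  : Injective _≡_ _≡_ ends

open Graph public

Elem : Graph → Set
Elem G = Fin (p G) ⊎ Fin (q G)

len : Graph → ℕ
len G = p G + q G

-- A construction sequence: a bijection x : {1..ℓ} → V ⊔ E (positions 0-based
-- here) such that every edge comes after both of its endpoints.
record CSeq (G : Graph) : Set where
  field
    x    : Fin (len G) ↔ Elem G
  pos : Elem G → ℕ
  pos a = toℕ (Inverse.from x a)
  field
    edgeAfter : ∀ e → pos (inj₁ (proj₁ (ends G e))) < pos (inj₂ e)
                    × pos (inj₁ (proj₂ (ends G e))) < pos (inj₂ e)

open CSeq public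

edgeCost : {G : Graph} → CSeq G → Fin (q G) → ℕ
edgeCost {G} s e =
  (pos s (inj₂ e) ∸ pos s (inj₁ (proj₁ (ends G e))))
  + (pos s (inj₂ e) ∸ pos s (inj₁ (proj₂ (ends G e))))

cost : {G : Graph} → CSeq G → ℕ
cost {G} s = sum (tabulate (edgeCost s))

-- ν(x) = ν*(G): x attains the maximum cost over all c-sequences.
IsMaxCost : {G : Graph} → CSeq G → Set
IsMaxCost {G} s = ∀ (t : CSeq G) → cost t ≤ cost s

deg : (G : Graph) → Fin (p G) → ℕ
deg G v = sum (tabulate λ e →
  if ⌊ (proj₁ (ends G e) ≟ v) ⊎-dec (proj₂ (ends G e) ≟ v) ⌋ then 1 else 0)

ConsecVertices : {G : Graph} → CSeq G → Fin (p G) → Fin (p G) → Set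
ConsecVertices {G} s u v =
  pos s (inj₁ u) < pos s (inj₁ v)
  × (¬ (∃[ w ] (pos s (inj₁ u) < pos s (inj₁ w) × pos s (inj₁ w) < pos s (inj₁ v))))

-- Let u, v be consecutive vertices of x, at positions a < b. Move v to just before u: the
-- entries at positions a, …, b - 1 shift one step right and nothing moves left except v.
-- Edges never sit at b and come after their endpoints, so this is again a c-sequence.
-- An end of an edge at v gains at least b - a ≥ 1, an end at u loses at most 1, and every
-- other end, whose vertex lies outside [a, b], gains at least 0. Hence the new cost is at
-- least ν(x) + deg v - deg u, and maximality of ν(x) forces deg u ≥ deg v.
module Submission where

open import Defs
open import Data.Nat using (_≥_)

open import Data.Bool using (if_then_else_)
open import Data.Fin.Base using (Fin; zero; suc; toℕ; punchIn; punchOut; _<_; _≤_)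
open import Data.Fin.Permutation using (Permutation; _⟨$⟩ʳ_; insert; id; flip)
open import Data.Fin.Properties using (_≟_; _<?_; punchOut-cong; toℕ-injective; <⇒≢)
open import Data.List using (tabulate)
open import Data.Nat as ℕ using (ℕ; suc; _+_; _∸_; s≤s)
open import Data.Nat.ListAction using (sum)
import Data.Nat.Properties as ℕₚ
open import Algebra.Properties.CommutativeSemigroup ℕₚ.+-commutativeSemigroup using (interchange)
open import Data.Product using (_,_; proj₁; proj₂)
open import Data.Sum using (inj₁; inj₂)
open import Data.Sum.Properties using (inj₁-injective)
open import Function using (_∘_)
open import Function.Bundles using (Inverse)
open import Function.Construct.Composition using (_↔-∘_)
open import Relation.Binary.PropositionalEquality
open import Relation.Nullary using (yes; no; contradiction)
open import Relation.Nullary.Decidable using (⌊_⌋; _⊎-dec_)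

sum-tabulate-+-mono : ∀ {m} (f g h k : Fin m → ℕ) → (∀ i → f i + g i ℕ.≤ h i + k i) →
  sum (tabulate f) + sum (tabulate g) ℕ.≤ sum (tabulate h) + sum (tabulate k)
sum-tabulate-+-mono {ℕ.zero} f g h k le = ℕ.z≤n
sum-tabulate-+-mono {suc m} f g h k le = begin
  (f zero + sum (tabulate (f ∘ suc))) + (g zero + sum (tabulate (g ∘ suc)))
    ≡⟨ interchange (f zero) _ (g zero) _ ⟩
  (f zero + g zero) + (sum (tabulate (f ∘ suc)) + sum (tabulate (g ∘ suc)))
    ≤⟨ ℕₚ.+-mono-≤ (le zero) (sum-tabulate-+-mono (f ∘ suc) (g ∘ suc) (h ∘ suc) (k ∘ suc) (le ∘ suc)) ⟩
  (h zero + k zero) + (sum (tabulate (h ∘ suc)) + sum (tabulate (k ∘ suc)))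
    ≡⟨ interchange (h zero) (k zero) _ _ ⟩
  (h zero + sum (tabulate (h ∘ suc))) + (k zero + sum (tabulate (k ∘ suc))) ∎
  where open ℕₚ.≤-Reasoning

indicator : ∀ {n} → Fin n → Fin n → ℕ
indicator w v = if ⌊ w ≟ v ⌋ then 1 else 0

incidence : (G : Graph) → Fin (q G) → Fin (p G) → ℕ
incidence G e v = if ⌊ (proj₁ (ends G e) ≟ v) ⊎-dec (proj₂ (ends G e) ≟ v) ⌋ then 1 else 0

incidence-split : ∀ (G : Graph) e v →
  incidence G e v ≡ indicator (proj₁ (ends G e)) v + indicator (proj₂ (ends G e)) v
incidence-split G e v with proj₁ (ends G e) ≟ v | proj₂ (ends G e) ≟ v
... | yes refl | yes w₂≡w₁ = contradiction (cong toℕ (sym w₂≡w₁)) (ℕₚ.<⇒≢ (ordered G e))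
... | yes _    | no _    = refl
... | no _     | yes _   = refl
... | no _     | no _    = refl

toℕ-punchIn-< : ∀ {n} (i : Fin (suc n)) (j : Fin n) → j < i → toℕ (punchIn i j) ≡ toℕ j
toℕ-punchIn-< (suc i) zero    _         = refl
toℕ-punchIn-< (suc i) (suc j) (s≤s j<i) = cong suc (toℕ-punchIn-< i j j<i)

toℕ-punchIn-≥ : ∀ {n} (i : Fin (suc n)) (j : Fin n) → i ≤ j → toℕ (punchIn i j) ≡ suc (toℕ j)
toℕ-punchIn-≥ zero    j       _         = refl
toℕ-punchIn-≥ (suc i) (suc j) (s≤s i≤j) = cong suc (toℕ-punchIn-≥ i j i≤j)

toℕ-punchOut-< : ∀ {n} {i j : Fin (suc n)} (i≢j : i ≢ j) → j < i → toℕ (punchOut i≢j) ≡ toℕ j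
toℕ-punchOut-< {suc _} {suc i} {zero}  _   _         = refl
toℕ-punchOut-< {suc _} {suc i} {suc j} i≢j (s≤s j<i) = cong suc (toℕ-punchOut-< (i≢j ∘ cong suc) j<i)

suc-toℕ-punchOut : ∀ {n} {i j : Fin (suc n)} (i≢j : i ≢ j) → i < j → suc (toℕ (punchOut i≢j)) ≡ toℕ j
suc-toℕ-punchOut {_}     {zero}  {suc j} _   _         = refl
suc-toℕ-punchOut {suc _} {suc i} {suc j} i≢j (s≤s i<j) = cong suc (suc-toℕ-punchOut (i≢j ∘ cong suc) i<j)

insert-source : ∀ {m n} i j (π : Permutation m n) → insert i j π ⟨$⟩ʳ i ≡ j
insert-source i j π with i ≟ i
... | yes _   = refl
... | no  i≢i = contradiction refl i≢i

insert-punchOut : ∀ {m n} {i k} j (π : Permutation m n) (i≢k : i ≢ k) →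
                  insert i j π ⟨$⟩ʳ k ≡ punchIn j (π ⟨$⟩ʳ punchOut i≢k)
insert-punchOut {i = i} {k} j π i≢k with i ≟ k
... | yes i≡k = contradiction i≡k i≢k
... | no  _   = cong (λ l → punchIn j (π ⟨$⟩ʳ l)) (punchOut-cong i refl)

-- Read as a reordering of a sequence, π moves the entry at position b to just before
-- the entry at position a.
record MovesBefore {n} (b a : Fin n) (π : Permutation n n) : Set where
  field
    sends-source   : π ⟨$⟩ʳ b ≡ a
    fixes-below    : ∀ {k} → k < a → toℕ (π ⟨$⟩ʳ k) ≡ toℕ k
    shifts-between : ∀ {k} → a ≤ k → k < b → toℕ (π ⟨$⟩ʳ k) ≡ suc (toℕ k)
    fixes-above    : ∀ {k} → b < k → toℕ (π ⟨$⟩ʳ k) ≡ toℕ k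

moveBefore : ∀ {n} → Fin n → Fin n → Permutation n n
moveBefore {suc _} b a = insert b a id

moveBefore-movesBefore : ∀ {n} {b a : Fin n} → a < b → MovesBefore b a (moveBefore b a)
moveBefore-movesBefore {suc _} {b} {a} a<b = record
  { sends-source   = insert-source b a id
  ; fixes-below    = fixes-below
  ; shifts-between = shifts-between
  ; fixes-above    = fixes-above
  }
  where
  open ≡-Reasoning
  π = moveBefore b a

  π≡punchIn∘punchOut : ∀ {k} (b≢k : b ≢ k) → toℕ (π ⟨$⟩ʳ k) ≡ toℕ (punchIn a (punchOut b≢k))
  π≡punchIn∘punchOut b≢k = cong toℕ (insert-punchOut a id b≢k)

  fixes-below : ∀ {k} → k < a → toℕ (π ⟨$⟩ʳ k) ≡ toℕ k
  fixes-below {k} k<a = begin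
    toℕ (π ⟨$⟩ʳ k)                 ≡⟨ π≡punchIn∘punchOut b≢k ⟩
    toℕ (punchIn a (punchOut b≢k)) ≡⟨ toℕ-punchIn-< a _ (subst (ℕ._< toℕ a) (sym out≡k) k<a) ⟩
    toℕ (punchOut b≢k)             ≡⟨ out≡k ⟩
    toℕ k                          ∎
    where
    k<b = ℕₚ.<-trans k<a a<b
    b≢k = ≢-sym (<⇒≢ k<b)
    out≡k = toℕ-punchOut-< b≢k k<b

  shifts-between : ∀ {k} → a ≤ k → k < b → toℕ (π ⟨$⟩ʳ k) ≡ suc (toℕ k)
  shifts-between {k} a≤k k<b = begin
    toℕ (π ⟨$⟩ʳ k)                 ≡⟨ π≡punchIn∘punchOut b≢k ⟩
    toℕ (punchIn a (punchOut b≢k)) ≡⟨ toℕ-punchIn-≥ a _ (subst (toℕ a ℕ.≤_) (sym out≡k) a≤k) ⟩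
    suc (toℕ (punchOut b≢k))       ≡⟨ cong suc out≡k ⟩
    suc (toℕ k)                    ∎
    where
    b≢k = ≢-sym (<⇒≢ k<b)
    out≡k = toℕ-punchOut-< b≢k k<b

  fixes-above : ∀ {k} → b < k → toℕ (π ⟨$⟩ʳ k) ≡ toℕ k
  fixes-above {k} b<k = begin
    toℕ (π ⟨$⟩ʳ k)                 ≡⟨ π≡punchIn∘punchOut b≢k ⟩
    toℕ (punchIn a (punchOut b≢k)) ≡⟨ toℕ-punchIn-≥ a _ (ℕₚ.≤-trans (ℕₚ.<⇒≤ a<b) b≤out) ⟩
    suc (toℕ (punchOut b≢k))       ≡⟨ suc-out≡k ⟩
    toℕ k                          ∎
    where
    b≢k = <⇒≢ b<k
    suc-out≡k = suc-toℕ-punchOut b≢k b<k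
    b≤out = ℕ.s≤s⁻¹ (subst (toℕ b ℕ.<_) (sym suc-out≡k) b<k)

data Region {n} (a b k : Fin n) : Set where
  below   : k < a → Region a b k
  between : a ≤ k → k < b → Region a b k
  source  : k ≡ b → Region a b k
  above   : b < k → Region a b k

region : ∀ {n} (a b k : Fin n) → Region a b k
region a b k with k <? a
... | yes k<a = below k<a
... | no  k≮a with k <? b
...   | yes k<b = between (ℕₚ.≮⇒≥ k≮a) k<b
...   | no  k≮b with k ≟ b
...     | yes k≡b = source k≡b
...     | no  k≢b = above (ℕₚ.≤∧≢⇒< (ℕₚ.≮⇒≥ k≮b) (k≢b ∘ sym ∘ toℕ-injective))

module MovesBeforeProperties {n} {b a : Fin n} {π : Permutation n n}
                             (a<b : a < b) (mb : MovesBefore b a π) where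
  open MovesBefore mb

  inflationary : ∀ {k : Fin n} → k ≢ b → k ≤ π ⟨$⟩ʳ k
  inflationary {k} k≢b with region a b k
  ... | below k<a       = ℕₚ.≤-reflexive (sym (fixes-below k<a))
  ... | between a≤k k<b = ℕₚ.≤-trans (ℕₚ.n≤1+n _) (ℕₚ.≤-reflexive (sym (shifts-between a≤k k<b)))
  ... | source k≡b      = contradiction k≡b k≢b
  ... | above b<k       = ℕₚ.≤-reflexive (sym (fixes-above b<k))

  moved≤suc : ∀ k → toℕ (π ⟨$⟩ʳ k) ℕ.≤ suc (toℕ k)
  moved≤suc k with region a b k
  ... | below k<a       = ℕₚ.≤-trans (ℕₚ.≤-reflexive (fixes-below k<a)) (ℕₚ.n≤1+n _)
  ... | between a≤k k<b = ℕₚ.≤-reflexive (shifts-between a≤k k<b)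
  ... | source refl     = ℕₚ.≤-trans (ℕₚ.≤-reflexive (cong toℕ sends-source)) (ℕₚ.≤-trans (ℕₚ.<⇒≤ a<b) (ℕₚ.n≤1+n _))
  ... | above b<k       = ℕₚ.≤-trans (ℕₚ.≤-reflexive (fixes-above b<k)) (ℕₚ.n≤1+n _)

  below-stays-below : ∀ {i j : Fin n} → i < j → b < j → π ⟨$⟩ʳ i < j
  below-stays-below {i} i<j b<j with region a b i
  ... | below i<a       = subst (ℕ._< _) (sym (fixes-below i<a)) i<j
  ... | between a≤i i<b = subst (ℕ._< _) (sym (shifts-between a≤i i<b)) (ℕₚ.≤-<-trans i<b b<j)
  ... | source refl     = subst (ℕ._< _) (sym (cong toℕ sends-source)) (ℕₚ.<-trans a<b b<j)
  ... | above b<i       = subst (ℕ._< _) (sym (fixes-above b<i)) i<j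

  monotone : ∀ {i j : Fin n} → i < j → j ≢ b → π ⟨$⟩ʳ i < π ⟨$⟩ʳ j
  monotone {i} {j} i<j j≢b with region a b j
  ... | below j<a       = subst₂ ℕ._<_ (sym (fixes-below (ℕₚ.<-trans i<j j<a))) (sym (fixes-below j<a)) i<j
  ... | between a≤j j<b = subst (_ ℕ.<_) (sym (shifts-between a≤j j<b)) (s≤s (ℕₚ.≤-trans (moved≤suc i) i<j))
  ... | source j≡b      = contradiction j≡b j≢b
  ... | above b<j       = subst (_ ℕ.<_) (sym (fixes-above b<j)) (below-stays-below i<j b<j)

  distance-from-source : ∀ {k : Fin n} → b < k →
    suc (toℕ k ∸ toℕ b) ℕ.≤ toℕ (π ⟨$⟩ʳ k) ∸ toℕ (π ⟨$⟩ʳ b)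
  distance-from-source {k} b<k = begin
    suc (toℕ k ∸ toℕ b)          ≤⟨ ℕₚ.∸-monoʳ-< a<b (ℕₚ.<⇒≤ b<k) ⟩
    toℕ k ∸ toℕ a                ≤⟨ ℕₚ.∸-monoˡ-≤ (toℕ a) (inflationary (≢-sym (<⇒≢ b<k))) ⟩
    toℕ (π ⟨$⟩ʳ k) ∸ toℕ a         ≡⟨ cong (λ c → toℕ (π ⟨$⟩ʳ k) ∸ toℕ c) sends-source ⟨
    toℕ (π ⟨$⟩ʳ k) ∸ toℕ (π ⟨$⟩ʳ b) ∎
    where open ℕₚ.≤-Reasoning

  distance-from-target : ∀ {k : Fin n} → a < k → k ≢ b →
    toℕ k ∸ toℕ a ℕ.≤ suc (toℕ (π ⟨$⟩ʳ k) ∸ toℕ (π ⟨$⟩ʳ a))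
  distance-from-target {k} a<k k≢b = begin
    toℕ k ∸ toℕ a                     ≤⟨ ℕₚ.∸-monoˡ-≤ (toℕ a) k≤πk ⟩
    suc (toℕ (π ⟨$⟩ʳ k)) ∸ suc (toℕ a)  ≡⟨ ℕₚ.+-∸-assoc 1 (ℕₚ.<-≤-trans a<k k≤πk) ⟩
    suc (toℕ (π ⟨$⟩ʳ k) ∸ suc (toℕ a))  ≡⟨ cong (λ c → suc (toℕ (π ⟨$⟩ʳ k) ∸ c)) (shifts-between ℕₚ.≤-refl a<b) ⟨
    suc (toℕ (π ⟨$⟩ʳ k) ∸ toℕ (π ⟨$⟩ʳ a)) ∎
    where
    open ℕₚ.≤-Reasoning
    k≤πk = inflationary k≢b

  distance-from-fixed : ∀ {i k : Fin n} → k ≢ b → toℕ (π ⟨$⟩ʳ i) ≡ toℕ i →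
    toℕ k ∸ toℕ i ℕ.≤ toℕ (π ⟨$⟩ʳ k) ∸ toℕ (π ⟨$⟩ʳ i)
  distance-from-fixed {i} {k} k≢b πi≡i = subst (toℕ k ∸ toℕ i ℕ.≤_) (cong (toℕ (π ⟨$⟩ʳ k) ∸_) (sym πi≡i))
                                     (ℕₚ.∸-monoˡ-≤ (toℕ i) (inflationary k≢b))

at : {G : Graph} → CSeq G → Elem G → Fin (len G)
at s = Inverse.from (x s)

at-injective : ∀ {G} (s : CSeq G) {c d : Elem G} → at s c ≡ at s d → c ≡ d
at-injective s {c} {d} eq = begin
  c                         ≡⟨ Inverse.strictlyInverseˡ (x s) c ⟨
  Inverse.to (x s) (at s c) ≡⟨ cong (Inverse.to (x s)) eq ⟩
  Inverse.to (x s) (at s d) ≡⟨ Inverse.strictlyInverseˡ (x s) d ⟩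
  d                         ∎
  where open ≡-Reasoning

reorder : ∀ {G} (s : CSeq G) (π : Permutation (len G) (len G)) →
          (∀ e {i} → i < at s (inj₂ e) → π ⟨$⟩ʳ i < π ⟨$⟩ʳ at s (inj₂ e)) → CSeq G
reorder s π keeps = record
  { x         = x s ↔-∘ flip π
  ; edgeAfter = λ e → keeps e (proj₁ (edgeAfter s e)) , keeps e (proj₂ (edgeAfter s e))
  }

module Exchange {G : Graph} (s : CSeq G) {u v : Fin (p G)} (uv : ConsecVertices s u v)
                {π : Permutation (len G) (len G)}
                (mb : MovesBefore (at s (inj₁ v)) (at s (inj₁ u)) π) where
  open MovesBefore mb
  open MovesBeforeProperties (proj₁ uv) mb

  edge-not-at-v : ∀ e → at s (inj₂ e) ≢ at s (inj₁ v)
  edge-not-at-v e eq with at-injective s eq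
  ... | ()

  moved : CSeq G
  moved = reorder s π (λ e i<e → monotone i<e (edge-not-at-v e))

  fixes-other-vertices : ∀ {w} → w ≢ u → w ≢ v →
    toℕ (π ⟨$⟩ʳ at s (inj₁ w)) ≡ pos s (inj₁ w)
  fixes-other-vertices {w} w≢u w≢v with region (at s (inj₁ u)) (at s (inj₁ v)) (at s (inj₁ w))
  ... | below w<u       = fixes-below w<u
  ... | above v<w       = fixes-above v<w
  ... | source w≡v      = contradiction (inj₁-injective (at-injective s w≡v)) w≢v
  ... | between u≤w w<v with at s (inj₁ u) ≟ at s (inj₁ w)
  ...   | yes u≡w = contradiction (sym (inj₁-injective (at-injective s u≡w))) w≢u
  ...   | no  u≢w = contradiction (w , ℕₚ.≤∧≢⇒< u≤w (u≢w ∘ toℕ-injective) , w<v) (proj₂ uv)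

  endpoint-exchange : ∀ e w → pos s (inj₁ w) ℕ.< pos s (inj₂ e) →
    (pos s (inj₂ e) ∸ pos s (inj₁ w)) + indicator w v
      ℕ.≤ (pos moved (inj₂ e) ∸ pos moved (inj₁ w)) + indicator w u
  endpoint-exchange e w w<e with w ≟ v | w ≟ u
  ... | yes refl | yes v≡u = contradiction (cong (λ c → pos s (inj₁ c)) v≡u) (ℕₚ.>⇒≢ (proj₁ uv))
  ... | yes refl | no  _   = subst₂ ℕ._≤_ (ℕₚ.+-comm 1 _) (sym (ℕₚ.+-identityʳ _)) (distance-from-source w<e)
  ... | no  _    | yes refl = subst₂ ℕ._≤_ (sym (ℕₚ.+-identityʳ _)) (ℕₚ.+-comm 1 _)
                                (distance-from-target w<e (edge-not-at-v e))
  ... | no  w≢v  | no  w≢u = ℕₚ.+-monoˡ-≤ 0 (distance-from-fixed (edge-not-at-v e) (fixes-other-vertices w≢u w≢v))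

  edge-exchange : ∀ e → edgeCost s e + incidence G e v ℕ.≤ edgeCost moved e + incidence G e u
  edge-exchange e = begin
    edgeCost s e + incidence G e v
      ≡⟨ cong (edgeCost s e +_) (incidence-split G e v) ⟩
    edgeCost s e + (indicator w₁ v + indicator w₂ v)
      ≡⟨ interchange (pos s (inj₂ e) ∸ pos s (inj₁ w₁)) _ _ _ ⟩
    (pos s (inj₂ e) ∸ pos s (inj₁ w₁) + indicator w₁ v) + (pos s (inj₂ e) ∸ pos s (inj₁ w₂) + indicator w₂ v)
      ≤⟨ ℕₚ.+-mono-≤ (endpoint-exchange e w₁ (proj₁ (edgeAfter s e))) (endpoint-exchange e w₂ (proj₂ (edgeAfter s e))) ⟩
    (pos moved (inj₂ e) ∸ pos moved (inj₁ w₁) + indicator w₁ u) + (pos moved (inj₂ e) ∸ pos moved (inj₁ w₂) + indicator w₂ u)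
      ≡⟨ interchange (pos moved (inj₂ e) ∸ pos moved (inj₁ w₁)) _ _ _ ⟩
    edgeCost moved e + (indicator w₁ u + indicator w₂ u)
      ≡⟨ cong (edgeCost moved e +_) (incidence-split G e u) ⟨
    edgeCost moved e + incidence G e u ∎
    where
    open ℕₚ.≤-Reasoning
    w₁ = proj₁ (ends G e)
    w₂ = proj₂ (ends G e)

  cost-exchange : cost s + deg G v ℕ.≤ cost moved + deg G u
  cost-exchange = sum-tabulate-+-mono _ _ _ _ edge-exchange

lemma3 : (G : Graph) (s : CSeq G) → IsMaxCost s →
         ∀ u v → ConsecVertices s u v → deg G u ≥ deg G v
lemma3 G s maximal u v uv = ℕₚ.+-cancelˡ-≤ (cost s) _ _ (begin
  cost s + deg G v     ≤⟨ cost-exchange ⟩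
  cost moved + deg G u ≤⟨ ℕₚ.+-monoˡ-≤ (deg G u) (maximal moved) ⟩
  cost s + deg G u     ∎)
  where
  open ℕₚ.≤-Reasoning
  open Exchange s uv (moveBefore-movesBefore (proj₁ uv))
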